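{- Let $u, v, w$ be intentic states over $\mathcal{L}$. If $u \leq_F v$ and $v \leq_F w$, then $u \leq_F w$. Moreover, if $u \leq_F v$, then $u \leq_\Vdash v$.
   Context: Let $\mathcal{L}$ be a purely relational first-order language. Set $\mathcal{L}_0=\mathcal{L}$, let $\mathcal{L}_{i+1}$ be $\mathcal{L}_i$ augmented with a constant symbol $c_\varphi$ for each $\varphi(x)\in\mathcal{L}_i$ whose sole free variable is $x$, and $\mathcal{L}_\omega=\bigcup_{i<\omega}\mathcal{L}_i$. $\vdash$ is classical natural deduction (with LEM as an axiom schema). Non-hypothetical logic, with deductive relation written $\vdash_{\mathrm{NH}}$ (in the paper: $\vdash$ with a struck-through subscript $H$), is natural deduction without ${\rightarrow}I$, and with $\vee E$, $\exists E$ replaced by: from $\varphi\vee\psi$, $\varphi\rightarrow\theta$, $\psi\rightarrow\theta$ infer $\theta$; and from $\exists x\varphi(x)$, $\varphi(c_\varphi)\rightarrow\theta$ infer $\theta$. For a finite set of formulas $d$, $[d]$ is the closure of $d$ under $\vdash_{\mathrm{NH}}$, and $d+\varphi=d\cup\{\varphi\}$. A basic intentic state (of order $i$) is a set $b$ of $\mathcal{L}_i$-formulas with $b=[d]$ for some finite $d\subseteq b$. An intentic state $u$ is defined by $\in$-recursion as a pair $\langle b(u),H(u)\rangle$ where $b(u)$ is a basic intentic state and $H(u)$ is a finite set of intentic states such that for each $s\in H(u)$ there is $\varphi\in\mathcal{L}_\omega$ with $b(u)+\varphi=b(s)$. $\mathrm{MT}(u)$ is defined by $\in$-recursion as the $\subseteq$-least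 set such that: (i) $b(u)\subseteq\mathrm{MT}(u)$; (ii) for any $s\in H(u)$ and $\varphi,\theta\in\mathcal{L}_\omega$, if $b(u)+\varphi\vdash_{\mathrm{NH}} b(s)$ and $\theta\in\mathrm{MT}(s)$ then $(\varphi\rightarrow\theta)\in\mathrm{MT}(u)$; (iii) $\mathrm{MT}(u)$ is closed under $\vdash_{\mathrm{NH}}$. $u\leq_\Vdash v$ means $\mathrm{MT}(u)\subseteq\mathrm{MT}(v)$. By $\in$-recursion, $u\leq_F v$ ($v$ is a fine extension of $u$) means $b(u)=b(v)$ and for each $s\in H(u)$ there is $t\in H(v)$ with $s\leq_F t$. -}

module Defs where

open import Level using (Level; _⊔_) renaming (suc to lsuc; zero to lzero)
open import Data.Nat using (ℕ; zero; suc; _≤_) renaming (_⊔_ to _⊔ₙ_)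
open import Data.Fin using (Fin; zero; suc)
open import Data.Vec using (Vec; []; _∷_)
open import Data.List using (List)
open import Data.List.Membership.Propositional using (_∈_)
open import Data.Product using (Σ; _×_; _,_; ∃)
open import Data.Sum using (_⊎_)
open import Relation.Binary.PropositionalEquality using (_≡_)

record Language : Set₁ where
  field
    Sym   : Set
    arity : Sym → ℕ

module _ (𝓛 : Language) where
  open Language 𝓛

  -- Terms and formulas of L_ω (scoped de Bruijn: index n = number of
  -- free variables in scope).  The only closed terms are the constants
  -- c_φ, one for every formula φ(x) of L_ω whose only free variable is x
  -- (i.e. φ : Formula 1).

  data Term (n : ℕ) : Set
  data Formula (n : ℕ) : Set

  data Term n where
    var : Fin n → Term n
    c   : Formula 1 → Term n

  infixr 6 _∧'_
  infixr 5 _∨'_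
  infixr 4 _⇒_

  data Formula n where
    rel  : (R : Sym) → Vec (Term n) (arity R) → Formula n
    ⊥'   : Formula n
    _∧'_ : Formula n → Formula n → Formula n
    _∨'_ : Formula n → Formula n → Formula n
    _⇒_  : Formula n → Formula n → Formula n
    ∀'   : Formula (suc n) → Formula n
    ∃'   : Formula (suc n) → Formula n

  ¬' : ∀ {n} → Formula n → Formula n
  ¬' φ = φ ⇒ ⊥'

  Sentence : Set
  Sentence = Formula 0

  -- Order: φ ∈ L_i  iff  order φ ≤ i.

  orderT : ∀ {n} → Term n → ℕ
  orderTs : ∀ {n k} → Vec (Term n) k → ℕ
  orderF : ∀ {n} → Formula n → ℕ

  orderT (var _) = 0
  orderT (c φ)   = suc (orderF φ)

  orderTs []       = 0
  orderTs (t ∷ ts) = orderT t ⊔ₙ orderTs ts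

  orderF (rel R ts) = orderTs ts
  orderF ⊥'         = 0
  orderF (φ ∧' ψ)   = orderF φ ⊔ₙ orderF ψ
  orderF (φ ∨' ψ)   = orderF φ ⊔ₙ orderF ψ
  orderF (φ ⇒ ψ)    = orderF φ ⊔ₙ orderF ψ
  orderF (∀' φ)     = orderF φ
  orderF (∃' φ)     = orderF φ

  renT : ∀ {m n} → (Fin m → Fin n) → Term m → Term n
  renT ρ (var i) = var (ρ i)
  renT ρ (c φ)   = c φ

  renTs : ∀ {m n k} → (Fin m → Fin n) → Vec (Term m) k → Vec (Term n) k
  renTs ρ []       = []
  renTs ρ (t ∷ ts) = renT ρ t ∷ renTs ρ ts

  ext : ∀ {m n} → (Fin m → Fin n) → Fin (suc m) → Fin (suc n)
  ext ρ zero    = zero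
  ext ρ (suc i) = suc (ρ i)

  renF : ∀ {m n} → (Fin m → Fin n) → Formula m → Formula n
  renF ρ (rel R ts) = rel R (renTs ρ ts)
  renF ρ ⊥'         = ⊥'
  renF ρ (φ ∧' ψ)   = renF ρ φ ∧' renF ρ ψ
  renF ρ (φ ∨' ψ)   = renF ρ φ ∨' renF ρ ψ
  renF ρ (φ ⇒ ψ)    = renF ρ φ ⇒ renF ρ ψ
  renF ρ (∀' φ)     = ∀' (renF (ext ρ) φ)
  renF ρ (∃' φ)     = ∃' (renF (ext ρ) φ)

  subT : ∀ {m n} → (Fin m → Term n) → Term m → Term n
  subT σ (var i) = σ i
  subT σ (c φ)   = c φ

  subTs : ∀ {m n k} → (Fin m → Term n) → Vec (Term m) k → Vec (Term n) k
  subTs σ []       = []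
  subTs σ (t ∷ ts) = subT σ t ∷ subTs σ ts

  exts : ∀ {m n} → (Fin m → Term n) → Fin (suc m) → Term (suc n)
  exts σ zero    = var zero
  exts σ (suc i) = renT suc (σ i)

  subF : ∀ {m n} → (Fin m → Term n) → Formula m → Formula n
  subF σ (rel R ts) = rel R (subTs σ ts)
  subF σ ⊥'         = ⊥'
  subF σ (φ ∧' ψ)   = subF σ φ ∧' subF σ ψ
  subF σ (φ ∨' ψ)   = subF σ φ ∨' subF σ ψ
  subF σ (φ ⇒ ψ)    = subF σ φ ⇒ subF σ ψ
  subF σ (∀' φ)     = ∀' (subF (exts σ) φ)
  subF σ (∃' φ)     = ∃' (subF (exts σ) φ)

  _[_] : ∀ {n} → Formula (suc n) → Term n → Formula n
  φ [ t ] = subF σ φ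
    where
    σ : Fin (suc _) → Term _
    σ zero    = t
    σ (suc i) = var i

  wk : ∀ {n} → Sentence → Formula n
  wk = renF (λ ())

  lift1 : ∀ {n} → Formula 1 → Formula (suc n)
  lift1 = renF (λ _ → zero)

  -- Non-hypothetical logic ⊢NH: classical natural deduction (LEM as an
  -- axiom schema) without →I, with ∨E and ∃E replaced by their
  -- non-discharging versions.  No rule discharges hypotheses, so the
  -- premises Γ (a set of sentences) are global; free variables of
  -- Formula n are eigenvariables (∀I).

  data NH {ℓ : Level} (Γ : Sentence → Set ℓ) : (n : ℕ) → Formula n → Set ℓ where
    assume : ∀ {n ψ} → Γ ψ → NH Γ n (wk ψ)
    lem    : ∀ {n} (φ : Formula n) → NH Γ n (φ ∨' ¬' φ)
    ⊥E     : ∀ {n} (φ : Formula n) → NH Γ n ⊥' → NH Γ n φ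
    ∧I     : ∀ {n φ ψ} → NH Γ n φ → NH Γ n ψ → NH Γ n (φ ∧' ψ)
    ∧E₁    : ∀ {n φ ψ} → NH Γ n (φ ∧' ψ) → NH Γ n φ
    ∧E₂    : ∀ {n φ ψ} → NH Γ n (φ ∧' ψ) → NH Γ n ψ
    ∨I₁    : ∀ {n φ} (ψ : Formula n) → NH Γ n φ → NH Γ n (φ ∨' ψ)
    ∨I₂    : ∀ {n ψ} (φ : Formula n) → NH Γ n ψ → NH Γ n (φ ∨' ψ)
    ∨E'    : ∀ {n φ ψ θ} → NH Γ n (φ ∨' ψ) → NH Γ n (φ ⇒ θ)
             → NH Γ n (ψ ⇒ θ) → NH Γ n θ
    ⇒E     : ∀ {n φ ψ} → NH Γ n (φ ⇒ ψ) → NH Γ n φ → NH Γ n ψ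
    ∀I     : ∀ {n φ} → NH Γ (suc n) φ → NH Γ n (∀' φ)
    ∀E     : ∀ {n φ} → NH Γ n (∀' φ) → (t : Term n) → NH Γ n (φ [ t ])
    ∃I     : ∀ {n} (φ : Formula (suc n)) (t : Term n) → NH Γ n (φ [ t ])
             → NH Γ n (∃' φ)
    ∃E'    : ∀ {n θ} (φ : Formula 1) → NH Γ n (∃' (lift1 φ))
             → NH Γ n (wk (φ [ c φ ]) ⇒ θ) → NH Γ n θ

  _⊢NH_ : ∀ {ℓ} → (Sentence → Set ℓ) → Sentence → Set ℓ
  Γ ⊢NH φ = NH Γ 0 φ

  _⊢NH*_ : ∀ {ℓ ℓ'} → (Sentence → Set ℓ) → (Sentence → Set ℓ') → Set (ℓ ⊔ ℓ')
  Γ ⊢NH* Δ = ∀ φ → Δ φ → Γ ⊢NH φ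

  SSet : Set₁
  SSet = Sentence → Set

  _⊆_ : ∀ {ℓ ℓ'} → (Sentence → Set ℓ) → (Sentence → Set ℓ') → Set (ℓ ⊔ ℓ')
  A ⊆ B = ∀ φ → A φ → B φ

  _≐_ : SSet → SSet → Set
  A ≐ B = (A ⊆ B) × (B ⊆ A)

  _+_ : SSet → Sentence → SSet
  (A + φ) ψ = A ψ ⊎ ψ ≡ φ

  ⟦_⟧ : List Sentence → SSet
  ⟦ d ⟧ ψ = ψ ∈ d

  Cl : ℕ → SSet → SSet
  Cl i Γ φ = (orderF φ ≤ i) × (Γ ⊢NH φ)

  BasicOfOrder : ℕ → SSet → Set
  BasicOfOrder i b =
    (∀ φ → b φ → orderF φ ≤ i)
    × Σ (List Sentence) (λ d → (⟦ d ⟧ ⊆ b) × (b ≐ Cl i ⟦ d ⟧))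

  Basic : SSet → Set
  Basic b = ∃ λ i → BasicOfOrder i b

  -- Intentic states: pre-states (well-founded trees) plus a
  -- well-formedness predicate.

  data PreState : Set₁ where
    ⟨_,_⟩ : SSet → List PreState → PreState

  b : PreState → SSet
  b ⟨ x , _ ⟩ = x

  H : PreState → List PreState
  H ⟨ _ , h ⟩ = h

  data IntenticState : PreState → Set₁ where
    intentic : ∀ {b₀ H₀}
      → Basic b₀
      → (∀ {s} → s ∈ H₀ → IntenticState s)
      → (∀ {s} → s ∈ H₀ → ∃ λ φ → ∃ λ i → b s ≐ Cl i (b₀ + φ))
      → IntenticState ⟨ b₀ , H₀ ⟩

  data MT : PreState → Sentence → Set₁ where
    base  : ∀ {u φ} → b u φ → MT u φ
    cond  : ∀ {u s φ θ} → s ∈ H u → (b u + φ) ⊢NH* b s → MT s θ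
            → MT u (φ ⇒ θ)
    close : ∀ {u φ} → MT u ⊢NH φ → MT u φ

  _≤⊩_ : PreState → PreState → Set₁
  u ≤⊩ v = MT u ⊆ MT v

  data _≤F_ : PreState → PreState → Set₁ where
    fine : ∀ {u v} → b u ≐ b v
      → (∀ {s} → s ∈ H u → ∃ λ t → (t ∈ H v) × (s ≤F t))
      → u ≤F v

{-# OPTIONS --safe #-}
-- Both facts hold for arbitrary pre-states, by structural induction. A fine
-- extension v of u has the same base, and each hypothetical child s of u has a
-- fine extension t among those of v; since b(t) = b(s), the premise
-- b(u) + φ ⊢NH b(s) of a conditional φ ⇒ θ ∈ MT(u) carries over to t. Clause
-- (iii) closes MT under ⊢NH, so the induction runs through NH-derivations
-- from MT(u) as well.
module Submission where

open import Defs
open import Data.Product using (_×_; _,_)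
open import Data.Sum using (inj₁; inj₂)

module _ {𝓛 : Language} where

  ≐-trans : ∀ {A B C : SSet 𝓛} → _≐_ 𝓛 A B → _≐_ 𝓛 B C → _≐_ 𝓛 A C
  ≐-trans (A⊆B , B⊆A) (B⊆C , C⊆B) =
    (λ φ φ∈A → B⊆C φ (A⊆B φ φ∈A)) , (λ φ φ∈C → B⊆A φ (C⊆B φ φ∈C))

  +-mono-⊆ : ∀ {A B : SSet 𝓛} {φ} → _⊆_ 𝓛 A B → _⊆_ 𝓛 (_+_ 𝓛 A φ) (_+_ 𝓛 B φ)
  +-mono-⊆ A⊆B ψ (inj₁ ψ∈A) = inj₁ (A⊆B ψ ψ∈A)
  +-mono-⊆ A⊆B ψ (inj₂ ψ≡φ) = inj₂ ψ≡φ

  NH-mono : ∀ {ℓ ℓ'} {Γ : Sentence 𝓛 → Set ℓ} {Δ : Sentence 𝓛 → Set ℓ'} {n φ}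
    → _⊆_ 𝓛 Γ Δ → NH 𝓛 Γ n φ → NH 𝓛 Δ n φ
  NH-mono Γ⊆Δ (assume ψ∈Γ) = assume (Γ⊆Δ _ ψ∈Γ)
  NH-mono Γ⊆Δ (lem φ)       = lem φ
  NH-mono Γ⊆Δ (⊥E φ d)      = ⊥E φ (NH-mono Γ⊆Δ d)
  NH-mono Γ⊆Δ (∧I d e)      = ∧I (NH-mono Γ⊆Δ d) (NH-mono Γ⊆Δ e)
  NH-mono Γ⊆Δ (∧E₁ d)       = ∧E₁ (NH-mono Γ⊆Δ d)
  NH-mono Γ⊆Δ (∧E₂ d)       = ∧E₂ (NH-mono Γ⊆Δ d)
  NH-mono Γ⊆Δ (∨I₁ ψ d)     = ∨I₁ ψ (NH-mono Γ⊆Δ d)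
  NH-mono Γ⊆Δ (∨I₂ φ d)     = ∨I₂ φ (NH-mono Γ⊆Δ d)
  NH-mono Γ⊆Δ (∨E' d e f)   = ∨E' (NH-mono Γ⊆Δ d) (NH-mono Γ⊆Δ e) (NH-mono Γ⊆Δ f)
  NH-mono Γ⊆Δ (⇒E d e)      = ⇒E (NH-mono Γ⊆Δ d) (NH-mono Γ⊆Δ e)
  NH-mono Γ⊆Δ (∀I d)        = ∀I (NH-mono Γ⊆Δ d)
  NH-mono Γ⊆Δ (∀E d t)      = ∀E (NH-mono Γ⊆Δ d) t
  NH-mono Γ⊆Δ (∃I φ t d)    = ∃I φ t (NH-mono Γ⊆Δ d)
  NH-mono Γ⊆Δ (∃E' φ d e)   = ∃E' φ (NH-mono Γ⊆Δ d) (NH-mono Γ⊆Δ e)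

  ≤F-trans : ∀ {u v w} → _≤F_ 𝓛 u v → _≤F_ 𝓛 v w → _≤F_ 𝓛 u w
  ≤F-trans (fine bu≐bv refine-uv) (fine bv≐bw refine-vw) =
    fine (≐-trans bu≐bv bv≐bw) λ s∈Hu →
      let t , t∈Hv , s≤t = refine-uv s∈Hu
          r , r∈Hw , t≤r = refine-vw t∈Hv
      in r , r∈Hw , ≤F-trans s≤t t≤r

  -- NH-mono cannot be reused for the closure clause: the termination checker
  -- would not see that MT-mono-≤F is applied to subderivations only.
  mutual
    MT-mono-≤F : ∀ {u v φ} → _≤F_ 𝓛 u v → MT 𝓛 u φ → MT 𝓛 v φ
    MT-mono-≤F (fine (bu⊆bv , _) _) (base φ∈bu) = base (bu⊆bv _ φ∈bu)
    MT-mono-≤F (fine (bu⊆bv , _) refine) (cond s∈Hu bu+φ⊢bs θ∈MTs)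
      with refine s∈Hu
    ... | t , t∈Hv , s≤t@(fine (_ , bt⊆bs) _) =
      cond t∈Hv (λ ψ ψ∈bt → NH-mono (+-mono-⊆ bu⊆bv) (bu+φ⊢bs ψ (bt⊆bs ψ ψ∈bt)))
        (MT-mono-≤F s≤t θ∈MTs)
    MT-mono-≤F u≤v (close d) = close (MT-⊢NH-mono-≤F u≤v d)

    MT-⊢NH-mono-≤F : ∀ {u v n φ} → _≤F_ 𝓛 u v → NH 𝓛 (MT 𝓛 u) n φ → NH 𝓛 (MT 𝓛 v) n φ
    MT-⊢NH-mono-≤F u≤v (assume ψ∈MTu) = assume (MT-mono-≤F u≤v ψ∈MTu)
    MT-⊢NH-mono-≤F u≤v (lem φ)        = lem φ
    MT-⊢NH-mono-≤F u≤v (⊥E φ d)       = ⊥E φ (MT-⊢NH-mono-≤F u≤v d)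
    MT-⊢NH-mono-≤F u≤v (∧I d e)       = ∧I (MT-⊢NH-mono-≤F u≤v d) (MT-⊢NH-mono-≤F u≤v e)
    MT-⊢NH-mono-≤F u≤v (∧E₁ d)        = ∧E₁ (MT-⊢NH-mono-≤F u≤v d)
    MT-⊢NH-mono-≤F u≤v (∧E₂ d)        = ∧E₂ (MT-⊢NH-mono-≤F u≤v d)
    MT-⊢NH-mono-≤F u≤v (∨I₁ ψ d)      = ∨I₁ ψ (MT-⊢NH-mono-≤F u≤v d)
    MT-⊢NH-mono-≤F u≤v (∨I₂ φ d)      = ∨I₂ φ (MT-⊢NH-mono-≤F u≤v d)
    MT-⊢NH-mono-≤F u≤v (∨E' d e f)    =
      ∨E' (MT-⊢NH-mono-≤F u≤v d) (MT-⊢NH-mono-≤F u≤v e) (MT-⊢NH-mono-≤F u≤v f)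
    MT-⊢NH-mono-≤F u≤v (⇒E d e)       = ⇒E (MT-⊢NH-mono-≤F u≤v d) (MT-⊢NH-mono-≤F u≤v e)
    MT-⊢NH-mono-≤F u≤v (∀I d)         = ∀I (MT-⊢NH-mono-≤F u≤v d)
    MT-⊢NH-mono-≤F u≤v (∀E d t)       = ∀E (MT-⊢NH-mono-≤F u≤v d) t
    MT-⊢NH-mono-≤F u≤v (∃I φ t d)     = ∃I φ t (MT-⊢NH-mono-≤F u≤v d)
    MT-⊢NH-mono-≤F u≤v (∃E' φ d e)    = ∃E' φ (MT-⊢NH-mono-≤F u≤v d) (MT-⊢NH-mono-≤F u≤v e)

  ≤F⇒≤⊩ : ∀ {u v} → _≤F_ 𝓛 u v → _≤⊩_ 𝓛 u v
  ≤F⇒≤⊩ u≤v _ = MT-mono-≤F u≤v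

lemma1p3 : (𝓛 : Language) (u v w : PreState 𝓛)
    → IntenticState 𝓛 u → IntenticState 𝓛 v → IntenticState 𝓛 w
    → ((_≤F_ 𝓛 u v → _≤F_ 𝓛 v w → _≤F_ 𝓛 u w)
    × (_≤F_ 𝓛 u v → _≤⊩_ 𝓛 u v))
lemma1p3 𝓛 u v w _ _ _ = ≤F-trans , ≤F⇒≤⊩
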